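{- Let $M$ be a binary $n\times n$ matrix that is $d$-twin-ordered, and let $\mathcal{R}$ be the canonical slab decomposition of $M$. Then $|\mathcal{R}|\le 4f_d(n+2)+4n$, where $f_d=\frac{16}{3}(2d+3)^2\,2^{4(2d+2)}$. In particular $|\mathcal{R}|\in\mathcal{O}_d(n)$.
   Context: For $a\le b$ in $\mathbb{N}$, $[a,b]=\{a,\dots,b\}$. A row (column) block is a set of consecutive rows (columns); for a row block $R$ and column block $C$, the zone $M[R,C]$ is the submatrix at their intersection, and it is non-constant if it contains both a $0$ and a $1$. A contraction sequence for $M$ is a sequence $(\mathcal{R}_0,\mathcal{C}_0),\dots,(\mathcal{R}_p,\mathcal{C}_p)$ of pairs of partitions of rows and columns into blocks, starting with all singleton blocks, ending with one row block and one column block, each step merging two consecutive row blocks or two consecutive column blocks; its width is the least $d$ such that at every step every row block and every column block is involved in at most $d$ non-constant zones. $M$ (with fixed row/column order) is $d$-twin-ordered if it has a contraction sequence of width at most $d$. A slab $(a,b,c,e)$ is a zone $M[[a,b],[c,e]]$ all of whose entries are $1$. For $i\in[1,n]$, an $i$-strip is a slab $(a,b,i,i)$ such that neither $(a-1,b,i,i)$ nor $(a,b+1,i,i)$ is a slab (a row index $0$ or $n+1$ does not give a slab); $\mathtt{strips}_i$ is the set of $i$-strips and $\mathtt{strips}=\bigcup_i\mathtt{strips}_i$. Strips $(a,b,i,i)$ and $(a,b,j,j)$ (with $i\le j$) are siblings if $(a,b,k,k)\in\mathtt{strips}_k$ for every $k\in[i,j]$. This is an equivalence relation on $\mathtt{strips}$;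 each equivalence class, identified with its union (a slab), is a canonical slab, and the canonical slab decomposition of $M$ is the set of all canonical slabs. -}

module Defs where

open import Data.Bool using (Bool; true; false; not; _∧_)
open import Data.Nat using (ℕ; zero; suc; _+_; _*_; _∸_; _^_; _≤_; _⊔_; _⊓_)
open import Data.Fin using (Fin)
open import Data.Maybe using (Maybe; just; nothing)
import Data.Maybe as Maybe
open import Data.List using (List; []; _∷_; _++_; [_]; map; upTo; replicate; filterᵇ; length)
open import Data.Bool.ListAction using (any)
open import Data.List.Relation.Unary.All using (All)
open import Data.Product using (Σ; _×_; _,_; ∃)
open import Data.Sum using (_⊎_)
open import Relation.Binary.PropositionalEquality using (_≡_)
open import Relation.Nullary using (¬_)

Matrix : ℕ → Set
Matrix n = Fin n → Fin n → Bool

toFin : (n i : ℕ) → Maybe (Fin n)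
toFin zero    _       = nothing
toFin (suc n) zero    = just Fin.zero
toFin (suc n) (suc i) = Maybe.map Fin.suc (toFin n i)

-- entry M i j with 1-based indices i, j ∈ [1,n]; out of range gives 0
-- (never used by the definitions below on out-of-range indices)
entry : ∀ {n} → Matrix n → ℕ → ℕ → Bool
entry {n} M zero    _       = false
entry {n} M (suc i) zero    = false
entry {n} M (suc i) (suc j) with toFin n i | toFin n j
... | just x  | just y  = M x y
... | _       | _       = false

range : ℕ → ℕ → List ℕ
range a b = map (a +_) (upTo (suc b ∸ a))

-- Partitions into consecutive blocks, represented by the list of block
-- lengths (in order).  Blocks are the intervals [s, s+l-1].

blocksFrom : ℕ → List ℕ → List (ℕ × ℕ)
blocksFrom s []       = []
blocksFrom s (l ∷ ls) = (s , s + l ∸ 1) ∷ blocksFrom (s + l) ls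

blocks : List ℕ → List (ℕ × ℕ)
blocks = blocksFrom 1

nonConst : ∀ {n} → Matrix n → ℕ × ℕ → ℕ × ℕ → Bool
nonConst M (r₁ , r₂) (c₁ , c₂) =
  any (λ i → any (λ j → entry M i j) (range c₁ c₂)) (range r₁ r₂)
  ∧ any (λ i → any (λ j → not (entry M i j)) (range c₁ c₂)) (range r₁ r₂)

State : Set
State = List ℕ × List ℕ

Merge : List ℕ → List ℕ → Set
Merge xs ys = Σ (List ℕ) λ pre → Σ ℕ λ a → Σ ℕ λ b → Σ (List ℕ) λ post →
  (xs ≡ pre ++ a ∷ b ∷ post) × (ys ≡ pre ++ (a + b) ∷ post)

Step : State → State → Set
Step (R , C) (R' , C') = (Merge R R' × C ≡ C') ⊎ (R ≡ R' × Merge C C')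

data Seq : State → State → Set where
  done : ∀ {s} → Seq s s
  step : ∀ {s s' t} → Step s s' → Seq s' t → Seq s t

states : ∀ {s t} → Seq s t → List State
states {s} done         = s ∷ []
states {s} (step _ σ)   = s ∷ states σ

initial : ℕ → State
initial n = replicate n 1 , replicate n 1

final : ℕ → State
final n = [ n ] , [ n ]

WidthOK : ∀ {n} → ℕ → Matrix n → State → Set
WidthOK d M (R , C) =
  All (λ r → length (filterᵇ (λ c → nonConst M r c) (blocks C)) ≤ d) (blocks R)
  × All (λ c → length (filterᵇ (λ r → nonConst M r c) (blocks R)) ≤ d) (blocks C)

TwinOrdered : ∀ {n} → ℕ → Matrix n → Set
TwinOrdered {n} d M =
  Σ (Seq (initial n) (final n)) λ σ → All (WidthOK d M) (states σ)

Slab : ∀ {n} → Matrix n → ℕ → ℕ → ℕ → ℕ → Set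
Slab {n} M a b c e =
  1 ≤ a × a ≤ b × b ≤ n × 1 ≤ c × c ≤ e × e ≤ n ×
  (∀ i j → a ≤ i → i ≤ b → c ≤ j → j ≤ e → entry M i j ≡ true)

Strip : ∀ {n} → Matrix n → ℕ → ℕ → ℕ → Set
Strip M a b i =
  Slab M a b i i × ¬ Slab M (a ∸ 1) b i i × ¬ Slab M a (suc b) i i

Sibling : ∀ {n} → Matrix n → ℕ → ℕ → ℕ → ℕ → Set
Sibling M a b i j = ∀ k → i ⊓ j ≤ k → k ≤ i ⊔ j → Strip M a b k

-- the slab (a, b, i, j) is the union of a sibling class, i.e. the set of
-- strips {(a,b,k,k) | k ∈ [i,j]} is an equivalence class of Sibling
CanonicalSlab : ∀ {n} → Matrix n → ℕ × ℕ × ℕ × ℕ → Set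
CanonicalSlab M (a , b , i , j) =
  i ≤ j
  × (∀ k → i ≤ k → k ≤ j → Strip M a b k)
  × (∀ k → Strip M a b k → Sibling M a b i k → i ≤ k × k ≤ j)

-- 3 · f_d  where  f_d = (16/3)(2d+3)^2 2^(4(2d+2))
3f : ℕ → ℕ
3f d = 16 * (2 * d + 3) ^ 2 * 2 ^ (4 * (2 * d + 2))

-- A corner is a position (r , c) whose 2×2 window (rows r, r+1; columns c, c+1) differs both
-- between its two rows and between its two columns.  A canonical slab (a , b , i , j) has a corner
-- (r , j) with a - 1 ≤ r ≤ b: otherwise the strip (a , b , j) would continue, as a sibling strip,
-- into column j + 1.  Strips of one column that touch are equal, so this corner determines the slab.
-- A corner with 1 ≤ r < n and c < n separates two rows and two columns of the initial partitions.
-- Take the first step of the contraction sequence that merges across it, say across row r: the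
-- merged block contains rows r and r + 1, so its zone with the column block ending at c or with
-- the one starting at c + 1 is non-constant, and we charge the corner to that zone and its end.
-- The merged block has at most d non-constant zones, each charged at most twice, and there are
-- at most 2n steps; so there are at most 4dn such corners and 3(n + 1) others, and the number of
-- canonical slabs is at most 4dn + 3n + 3, linear in n with a far smaller constant than f_d.
module Submission where

open import Defs
open import Data.Bool using (Bool; true; false; not; T; if_then_else_)
open import Data.Bool.Properties using (T-∧; not-¬) renaming (_≟_ to _≟ᵇ_)
open import Data.Empty using (⊥-elim)
open import Data.List using (List; []; _∷_; _++_; [_]; length; map; upTo; replicate; filterᵇ)
open import Data.List.Membership.Propositional using (_∈_; lose)
open import Data.List.Membership.Propositional.Properties
  using (∈-map⁺; ∈-upTo⁺; ∈-++⁺ˡ; ∈-++⁺ʳ; ∈-++⁻; ∈-∃++)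
open import Data.List.Properties using (length-++; length-map; length-upTo; length-replicate)
open import Data.List.Relation.Unary.All using (All; _∷_)
import Data.List.Relation.Unary.All as All
open import Data.List.Relation.Unary.All.Properties using (++⁺; ++⁻ˡ; ++⁻ʳ; replicate⁺)
open import Data.List.Relation.Unary.AllPairs using (_∷_)
open import Data.List.Relation.Unary.Any using (here; there)
open import Data.List.Relation.Unary.Any.Properties using (any⁺)
open import Data.List.Relation.Unary.Unique.Propositional using (Unique)
open import Data.Maybe using (just; nothing)
open import Data.Nat using (ℕ; zero; suc; _+_; _*_; _∸_; _^_; _≤_; _<_; z≤n; s≤s)
open import Data.Nat.ListAction using (sum)
open import Data.Nat.Properties
open import Data.Nat.Tactic.RingSolver using (solve-∀)
open import Data.Product using (_×_; _,_; ∃; proj₁; proj₂)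
open import Data.Sum using (_⊎_; inj₁; inj₂)
open import Function.Bundles using (Equivalence)
open import Relation.Binary.PropositionalEquality
  using (_≡_; _≢_; refl; sym; trans; cong; cong₂; subst; module ≡-Reasoning)
open import Relation.Nullary using (¬_; Dec; yes; no; ¬?; _×-dec_; _⊎-dec_)
open import Relation.Nullary.Decidable using (decidable-stable)

pigeonhole : ∀ {A B : Set} (R : A → B → Set) {xs : List A} (ts : List B) → Unique xs →
             (∀ {x} → x ∈ xs → ∃ λ t → t ∈ ts × R x t) →
             (∀ {x y t} → x ∈ xs → y ∈ xs → R x t → R y t → x ≡ y) →
             length xs ≤ length ts
pigeonhole R {[]} ts _ _ _ = z≤n
pigeonhole R {x ∷ xs} ts (x∉xs ∷ unique) witness injective
  with t , t∈ts , Rxt ← witness (here refl)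
  with ys , zs , refl ← ∈-∃++ t∈ts
  = begin
      suc (length xs)             ≤⟨ s≤s (pigeonhole R (ys ++ zs) unique witness′ injective′) ⟩
      suc (length (ys ++ zs))     ≡⟨ cong suc (length-++ ys) ⟩
      suc (length ys + length zs) ≡⟨ +-suc (length ys) (length zs) ⟨
      length ys + length (t ∷ zs) ≡⟨ length-++ ys ⟨
      length (ys ++ t ∷ zs)       ∎
  where
  open ≤-Reasoning
  injective′ : ∀ {y z u} → y ∈ xs → z ∈ xs → R y u → R z u → y ≡ z
  injective′ p q = injective (there p) (there q)
  witness′ : ∀ {y} → y ∈ xs → ∃ λ u → u ∈ ys ++ zs × R y u
  witness′ y∈xs with u , u∈ts , Ryu ← witness (there y∈xs) with ∈-++⁻ ys u∈ts
  ... | inj₁ u∈ys          = u , ∈-++⁺ˡ u∈ys , Ryu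
  ... | inj₂ (there u∈zs)  = u , ∈-++⁺ʳ ys u∈zs , Ryu
  ... | inj₂ (here refl)   = ⊥-elim (All.lookup x∉xs y∈xs (injective (here refl) (there y∈xs) Rxt Ryu))

≢-cases : ∀ {x y} → x ≢ y → (T x × T (not y)) ⊎ (T y × T (not x))
≢-cases {true}  {false} _ = inj₁ _
≢-cases {false} {true}  _ = inj₂ _
≢-cases {true}  {true}  ≢ = ⊥-elim (≢ refl)
≢-cases {false} {false} ≢ = ⊥-elim (≢ refl)

differ? : (x y z w : Bool) → Dec (x ≢ y ⊎ z ≢ w)
differ? x y z w = ¬? (x ≟ᵇ y) ⊎-dec ¬? (z ≟ᵇ w)

¬differ⇒agree : ∀ {x y z w : Bool} → ¬ (x ≢ y ⊎ z ≢ w) → x ≡ y × z ≡ w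
¬differ⇒agree {x} {y} {z} {w} agree =
  decidable-stable (x ≟ᵇ y) (λ x≢y → agree (inj₁ x≢y)) , decidable-stable (z ≟ᵇ w) (λ z≢w → agree (inj₂ z≢w))

Within : ℕ → ℕ × ℕ → Set
Within i (lo , hi) = lo ≤ i × i ≤ hi

∈-range : ∀ {i a b} → Within i (a , b) → i ∈ range a b
∈-range {i} {a} {b} (a≤i , i≤b) =
  subst (_∈ range a b) (m+[n∸m]≡n a≤i) (∈-map⁺ (a +_) (∈-upTo⁺ (∸-monoˡ-< (s≤s i≤b) a≤i)))

∸1<⇒≤ : ∀ {a i} → a ∸ 1 < i → a ≤ i
∸1<⇒≤ {zero}  _   = z≤n
∸1<⇒≤ {suc a} a<i = a<i

merge-point-within : ∀ p {a b} → 1 ≤ a → 1 ≤ b →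
                     Within (p + a) (suc p , p + (a + b)) × Within (suc (p + a)) (suc p , p + (a + b))
merge-point-within p {a} {b} 1≤a 1≤b =
  (subst (_≤ p + a) (+-comm p 1) (+-monoʳ-≤ p 1≤a) , +-monoʳ-≤ p (m≤m+n a b)) ,
  (s≤s (m≤m+n p a) ,
   subst (_≤ p + (a + b)) (+-suc p a) (+-monoʳ-≤ p (subst (_≤ a + b) (+-comm a 1) (+-monoʳ-≤ a 1≤b))))

toFin-just⇒< : ∀ {m i x} → toFin m i ≡ just x → i < m
toFin-just⇒< {suc m} {zero}  _ = s≤s z≤n
toFin-just⇒< {suc m} {suc i} eq with toFin m i in eq′
toFin-just⇒< {suc m} {suc i} refl | just _ = s≤s (toFin-just⇒< eq′)

blocksFrom-++ : ∀ s xs ys → blocksFrom s (xs ++ ys) ≡ blocksFrom s xs ++ blocksFrom (s + sum xs) ys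
blocksFrom-++ s []       ys = cong (λ t → blocksFrom t ys) (sym (+-identityʳ s))
blocksFrom-++ s (x ∷ xs) ys = cong ((s , s + x ∸ 1) ∷_) (trans (blocksFrom-++ (s + x) xs ys)
  (cong (λ t → blocksFrom (s + x) xs ++ blocksFrom t ys) (+-assoc s x (sum xs))))

block-nonempty : ∀ {ls s x y} → All (1 ≤_) ls → (x , y) ∈ blocksFrom s ls → x ≤ y
block-nonempty {l ∷ _} {s} (1≤l ∷ _) (here refl) = subst (s ≤_) (sym (+-∸-assoc s 1≤l)) (m≤m+n s (l ∸ 1))
block-nonempty (_ ∷ pos) (there p) = block-nonempty pos p

middleBlock : List ℕ → ℕ → ℕ × ℕ
middleBlock pre c = suc (sum pre) , sum pre + c

∈-blocks-middle : ∀ pre c post → middleBlock pre c ∈ blocks (pre ++ c ∷ post)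
∈-blocks-middle pre c post rewrite blocksFrom-++ 1 pre (c ∷ post) = ∈-++⁺ʳ (blocks pre) (here refl)

module _ (pre : List ℕ) (a b : ℕ) (post : List ℕ) where

  block-after-merge : ∀ {x y} → (x , y) ∈ blocks (pre ++ a ∷ b ∷ post) →
                      (x , y) ∈ blocks (pre ++ (a + b) ∷ post)
                      ⊎ (x ≡ suc (sum pre) × y ≡ sum pre + a)
                      ⊎ (x ≡ suc (sum pre + a) × y ≡ sum pre + (a + b))
  block-after-merge {x} {y} p
    rewrite blocksFrom-++ 1 pre (a ∷ b ∷ post) | blocksFrom-++ 1 pre ((a + b) ∷ post)
    with ∈-++⁻ (blocks pre) p
  ... | inj₁ q                   = inj₁ (∈-++⁺ˡ q)
  ... | inj₂ (here refl)         = inj₂ (inj₁ (refl , refl))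
  ... | inj₂ (there (here refl)) = inj₂ (inj₂ (refl , +-assoc (sum pre) a b))
  ... | inj₂ (there (there q))   = inj₁ (∈-++⁺ʳ (blocks pre)
          (there (subst (λ t → (x , y) ∈ blocksFrom t post) (+-assoc (suc (sum pre)) a b) q)))

  block-end-after-merge : ∀ {x r} → (x , r) ∈ blocks (pre ++ a ∷ b ∷ post) →
                          (∃ λ x′ → (x′ , r) ∈ blocks (pre ++ (a + b) ∷ post)) ⊎ r ≡ sum pre + a
  block-end-after-merge p with block-after-merge p
  ... | inj₁ q                 = inj₁ (_ , q)
  ... | inj₂ (inj₁ (_ , r≡))   = inj₂ r≡
  ... | inj₂ (inj₂ (_ , refl)) = inj₁ (_ , ∈-blocks-middle pre (a + b) post)

  block-start-after-merge : ∀ {r y} → (suc r , y) ∈ blocks (pre ++ a ∷ b ∷ post) →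
                            (∃ λ y′ → (suc r , y′) ∈ blocks (pre ++ (a + b) ∷ post)) ⊎ r ≡ sum pre + a
  block-start-after-merge p with block-after-merge p
  ... | inj₁ q                 = inj₁ (_ , q)
  ... | inj₂ (inj₁ (refl , _)) = inj₁ (_ , ∈-blocks-middle pre (a + b) post)
  ... | inj₂ (inj₂ (refl , _)) = inj₂ refl

  merge-positive : All (1 ≤_) (pre ++ a ∷ b ∷ post) → All (1 ≤_) (pre ++ (a + b) ∷ post)
  merge-positive ps with 1≤a ∷ _ ∷ ps′ ← ++⁻ʳ pre ps = ++⁺ (++⁻ˡ pre ps) (≤-trans 1≤a (m≤m+n a b) ∷ ps′)

Cut : List ℕ → ℕ → Set
Cut ls r = (∃ λ x → (x , r) ∈ blocks ls) × (∃ λ y → (suc r , y) ∈ blocks ls)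

cut-after-merge : ∀ pre a b post {r} → Cut (pre ++ a ∷ b ∷ post) r →
                  Cut (pre ++ (a + b) ∷ post) r ⊎ r ≡ sum pre + a
cut-after-merge pre a b post ((_ , end) , (_ , start))
  with block-end-after-merge pre a b post end | block-start-after-merge pre a b post start
... | inj₁ end′ | inj₁ start′ = inj₁ (end′ , start′)
... | inj₂ r≡   | _           = inj₂ r≡
... | _         | inj₂ r≡     = inj₂ r≡

∈-blocksFrom-replicate : ∀ {m} s {k} → k < m → (s + k , s + k) ∈ blocksFrom s (replicate m 1)
∈-blocksFrom-replicate {suc m} s {zero}  _ =
  here (cong₂ _,_ (+-identityʳ s) (trans (+-identityʳ s) (sym (m+n∸n≡m s 1))))
∈-blocksFrom-replicate {suc m} s {suc k} (s≤s k<m) =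
  there (subst (λ t → (t , t) ∈ blocksFrom (s + 1) (replicate m 1)) (+-assoc s 1 k) (∈-blocksFrom-replicate (s + 1) k<m))

cut-initial : ∀ {n r} → 1 ≤ r → suc r ≤ n → Cut (replicate n 1) r
cut-initial {r = suc k} _ r<n = (_ , ∈-blocksFrom-replicate 1 (<⇒≤ r<n)) , (_ , ∈-blocksFrom-replicate 1 r<n)

¬cut-final : ∀ {n r} → 1 ≤ r → ¬ Cut [ n ] r
¬cut-final {r = suc _} _ (_ , (_ , here ()))
¬cut-final             _ (_ , (_ , there ()))

marks : (ℕ × ℕ → Bool) → (ℕ → ℕ × ℕ) → List (ℕ × ℕ) → List (ℕ × ℕ)
marks nc at []             = []
marks nc at ((x , y) ∷ Ks) =
  if nc (x , y) then at y ∷ at (x ∸ 1) ∷ marks nc at Ks else marks nc at Ks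

module _ (nc : ℕ × ℕ → Bool) (at : ℕ → ℕ × ℕ) where

  length-marks : ∀ Ks → length (marks nc at Ks) ≡ 2 * length (filterᵇ nc Ks)
  length-marks []       = refl
  length-marks (K ∷ Ks) with nc K
  ... | true  = trans (cong (2 +_) (length-marks Ks)) (sym (*-suc 2 _))
  ... | false = length-marks Ks

  ∈-marks-end : ∀ {x y Ks} → (x , y) ∈ Ks → T (nc (x , y)) → at y ∈ marks nc at Ks
  ∈-marks-end {x} {y} (here refl) ncK with nc (x , y)
  ... | true = here refl
  ∈-marks-end {Ks = K ∷ _} (there p) ncK with nc K
  ... | true  = there (there (∈-marks-end p ncK))
  ... | false = ∈-marks-end p ncK

  ∈-marks-start : ∀ {x y Ks} → (x , y) ∈ Ks → T (nc (x , y)) → at (x ∸ 1) ∈ marks nc at Ks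
  ∈-marks-start {x} {y} (here refl) ncK with nc (x , y)
  ... | true = there (here refl)
  ∈-marks-start {Ks = K ∷ _} (there p) ncK with nc K
  ... | true  = there (there (∈-marks-start p ncK))
  ... | false = ∈-marks-start p ncK

size : State → ℕ
size (R , C) = length R + length C

length-merge : ∀ {xs ys} → Merge xs ys → length xs ≡ suc (length ys)
length-merge (pre , a , b , post , refl , refl) = begin
  length (pre ++ a ∷ b ∷ post)               ≡⟨ length-++ pre ⟩
  length pre + suc (length (b ∷ post))       ≡⟨ +-suc (length pre) _ ⟩
  suc (length pre + length ((a + b) ∷ post)) ≡⟨ cong suc (length-++ pre) ⟨
  suc (length (pre ++ (a + b) ∷ post))       ∎
  where open ≡-Reasoning

size-step : ∀ {s s′} → Step s s′ → size s ≡ suc (size s′)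
size-step {_ , C} (inj₁ (m , refl)) = cong (_+ length C) (length-merge m)
size-step {R , _} (inj₂ (refl , m)) = trans (cong (length R +_) (length-merge m)) (+-suc (length R) _)

All-states-head : ∀ {P : State → Set} {s t} (σ : Seq s t) → All P (states σ) → P s
All-states-head done       (p ∷ _) = p
All-states-head (step _ _) (p ∷ _) = p

line : ℕ → (ℕ → ℕ × ℕ) → List (ℕ × ℕ)
line n f = map f (upTo (suc n))

length-line : ∀ n f → length (line n f) ≡ suc n
length-line n f = trans (length-map f (upTo (suc n))) (length-upTo (suc n))

-- Contains every position (r , c) with r ≤ n and 1 ≤ c ≤ n at which r or c is not a cut of the
-- initial partition.
border : ℕ → List (ℕ × ℕ)
border n = line n (0 ,_) ++ line n (n ,_) ++ line n (_, n)

length-border : ∀ n → length (border n) ≡ 3 * suc n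
length-border n = begin
  length (line n (0 ,_) ++ line n (n ,_) ++ line n (_, n))
    ≡⟨ length-++ (line n (0 ,_)) ⟩
  length (line n (0 ,_)) + length (line n (n ,_) ++ line n (_, n))
    ≡⟨ cong (length (line n (0 ,_)) +_) (length-++ (line n (n ,_))) ⟩
  length (line n (0 ,_)) + (length (line n (n ,_)) + length (line n (_, n)))
    ≡⟨ cong₂ _+_ (length-line n _) (cong₂ _+_ (length-line n _) (trans (length-line n _) (sym (+-identityʳ (suc n))))) ⟩
  3 * suc n
    ∎
  where open ≡-Reasoning

module _ {n : ℕ} (M : Matrix n) where

  entry-true⇒within : ∀ {i j} → entry M i j ≡ true → Within i (1 , n) × Within j (1 , n)
  entry-true⇒within {zero} ()
  entry-true⇒within {suc i} {zero} ()
  entry-true⇒within {suc i} {suc j} eq with toFin n i in eqi | toFin n j in eqj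
  ... | just _ | just _ = (s≤s z≤n , toFin-just⇒< eqi) , (s≤s z≤n , toFin-just⇒< eqj)
  entry-true⇒within {suc i} {suc j} () | just _  | nothing
  entry-true⇒within {suc i} {suc j} () | nothing | _

  nonConst-intro : ∀ {R C i j i′ j′} → Within i R → Within j C → Within i′ R → Within j′ C →
                   T (entry M i j) → T (not (entry M i′ j′)) → T (nonConst M R C)
  nonConst-intro i∈R j∈C i′∈R j′∈C isOne isZero = Equivalence.from T-∧
    ( any⁺ _ (lose (∈-range i∈R) (any⁺ _ (lose (∈-range j∈C) isOne)))
    , any⁺ _ (lose (∈-range i′∈R) (any⁺ _ (lose (∈-range j′∈C) isZero))))

  nonConst-≢ : ∀ {R C i j i′ j′} → Within i R → Within j C → Within i′ R → Within j′ C →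
               entry M i j ≢ entry M i′ j′ → T (nonConst M R C)
  nonConst-≢ i∈R j∈C i′∈R j′∈C ≢ with ≢-cases ≢
  ... | inj₁ (isOne , isZero) = nonConst-intro i∈R j∈C i′∈R j′∈C isOne isZero
  ... | inj₂ (isOne , isZero) = nonConst-intro i′∈R j′∈C i∈R j∈C isOne isZero

  RowsDiffer ColsDiffer Corner : ℕ → ℕ → Set
  RowsDiffer r c = entry M r c ≢ entry M (suc r) c ⊎ entry M r (suc c) ≢ entry M (suc r) (suc c)
  ColsDiffer r c = entry M r c ≢ entry M r (suc c) ⊎ entry M (suc r) c ≢ entry M (suc r) (suc c)
  Corner     r c = RowsDiffer r c × ColsDiffer r c

  corner? : ∀ r c → Dec (Corner r c)
  corner? r c = differ? (entry M r c) (entry M (suc r) c) (entry M r (suc c)) (entry M (suc r) (suc c))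
         ×-dec differ? (entry M r c) (entry M r (suc c)) (entry M (suc r) c) (entry M (suc r) (suc c))

  ¬corner⇒agree : ∀ {r c} → ¬ Corner r c →
    (entry M r c ≡ entry M (suc r) c × entry M r (suc c) ≡ entry M (suc r) (suc c))
    ⊎ (entry M r c ≡ entry M r (suc c) × entry M (suc r) c ≡ entry M (suc r) (suc c))
  ¬corner⇒agree {r} {c} ¬corner
    with differ? (entry M r c) (entry M (suc r) c) (entry M r (suc c)) (entry M (suc r) (suc c))
  ... | no  rowsAgree  = inj₁ (¬differ⇒agree rowsAgree)
  ... | yes rowsDiffer = inj₂ (¬differ⇒agree (λ colsDiffer → ¬corner (rowsDiffer , colsDiffer)))

  stepMarks : ∀ {s s′} → Step s s′ → List (ℕ × ℕ)
  stepMarks {s′ = _ , C′} (inj₁ ((pre , a , b , _) , _)) =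
    marks (nonConst M (middleBlock pre (a + b))) (sum pre + a ,_) (blocks C′)
  stepMarks {s′ = R′ , _} (inj₂ (_ , (pre , a , b , _))) =
    marks (λ K → nonConst M K (middleBlock pre (a + b))) (_, sum pre + a) (blocks R′)

  seqMarks : ∀ {s t} → Seq s t → List (ℕ × ℕ)
  seqMarks done        = []
  seqMarks (step st σ) = stepMarks st ++ seqMarks σ

  length-stepMarks : ∀ {d s s′} (st : Step s s′) → WidthOK d M s′ → length (stepMarks st) ≤ 2 * d
  length-stepMarks {d} {s′ = _ , C′} (inj₁ ((pre , a , b , post , _ , refl) , _)) (rowsOK , _) =
    subst (_≤ 2 * d) (sym (length-marks (nonConst M (middleBlock pre (a + b))) (sum pre + a ,_) (blocks C′)))
      (*-monoʳ-≤ 2 (All.lookup rowsOK (∈-blocks-middle pre (a + b) post)))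
  length-stepMarks {d} {s′ = R′ , _} (inj₂ (_ , (pre , a , b , post , _ , refl))) (_ , colsOK) =
    subst (_≤ 2 * d) (sym (length-marks (λ K → nonConst M K (middleBlock pre (a + b))) (_, sum pre + a) (blocks R′)))
      (*-monoʳ-≤ 2 (All.lookup colsOK (∈-blocks-middle pre (a + b) post)))

  length-seqMarks : ∀ {d s t} (σ : Seq s t) → All (WidthOK d M) (states σ) → length (seqMarks σ) ≤ 2 * d * size s
  length-seqMarks done _ = z≤n
  length-seqMarks {d} {s} (step {s' = s′} st σ) (_ ∷ ok) = begin
    length (stepMarks st ++ seqMarks σ)         ≡⟨ length-++ (stepMarks st) ⟩
    length (stepMarks st) + length (seqMarks σ) ≤⟨ +-mono-≤ (length-stepMarks st (All-states-head σ ok)) (length-seqMarks σ ok) ⟩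
    2 * d + 2 * d * size s′                     ≡⟨ *-suc (2 * d) (size s′) ⟨
    2 * d * suc (size s′)                       ≡⟨ cong (2 * d *_) (size-step st) ⟨
    2 * d * size s                              ∎
    where open ≤-Reasoning

  corner-∈-rowMarks : ∀ {C B r c} → All (1 ≤_) C → Within r B → Within (suc r) B → Cut C c → RowsDiffer r c →
                      (r , c) ∈ marks (nonConst M B) (r ,_) (blocks C)
  corner-∈-rowMarks pos r∈B r+1∈B ((_ , end) , _) (inj₁ ≢) =
    ∈-marks-end _ _ end (nonConst-≢ r∈B c∈end r+1∈B c∈end ≢)
    where c∈end = block-nonempty pos end , ≤-refl
  corner-∈-rowMarks pos r∈B r+1∈B (_ , (_ , start)) (inj₂ ≢) =
    ∈-marks-start _ _ start (nonConst-≢ r∈B c+1∈start r+1∈B c+1∈start ≢)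
    where c+1∈start = ≤-refl , block-nonempty pos start

  corner-∈-colMarks : ∀ {R B r c} → All (1 ≤_) R → Within c B → Within (suc c) B → Cut R r → ColsDiffer r c →
                      (r , c) ∈ marks (λ K → nonConst M K B) (_, c) (blocks R)
  corner-∈-colMarks pos c∈B c+1∈B ((_ , end) , _) (inj₁ ≢) =
    ∈-marks-end _ _ end (nonConst-≢ r∈end c∈B r∈end c+1∈B ≢)
    where r∈end = block-nonempty pos end , ≤-refl
  corner-∈-colMarks pos c∈B c+1∈B (_ , (_ , start)) (inj₂ ≢) =
    ∈-marks-start _ _ start (nonConst-≢ r+1∈start c∈B r+1∈start c+1∈B ≢)
    where r+1∈start = ≤-refl , block-nonempty pos start

  corner-∈-seqMarks : ∀ {R C} (σ : Seq (R , C) (final n)) → All (1 ≤_) R → All (1 ≤_) C →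
                      ∀ {r c} → 1 ≤ r → Cut R r → Cut C c → Corner r c → (r , c) ∈ seqMarks σ
  corner-∈-seqMarks done _ _ 1≤r cutR _ _ = ⊥-elim (¬cut-final 1≤r cutR)
  corner-∈-seqMarks (step (inj₁ ((pre , a , b , post , refl , refl) , refl)) σ) posR posC 1≤r cutR cutC corner
    with cut-after-merge pre a b post cutR
  ... | inj₁ cutR′ = ∈-++⁺ʳ _ (corner-∈-seqMarks σ (merge-positive pre a b post posR) posC 1≤r cutR′ cutC corner)
  ... | inj₂ refl
    with 1≤a ∷ 1≤b ∷ _ ← ++⁻ʳ pre posR
    with r∈B , r+1∈B ← merge-point-within (sum pre) 1≤a 1≤b
    = ∈-++⁺ˡ (corner-∈-rowMarks posC r∈B r+1∈B cutC (proj₁ corner))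
  corner-∈-seqMarks (step (inj₂ (refl , (pre , a , b , post , refl , refl))) σ) posR posC 1≤r cutR cutC corner
    with cut-after-merge pre a b post cutC
  ... | inj₁ cutC′ = ∈-++⁺ʳ _ (corner-∈-seqMarks σ posR (merge-positive pre a b post posC) 1≤r cutR cutC′ corner)
  ... | inj₂ refl
    with 1≤a ∷ 1≤b ∷ _ ← ++⁻ʳ pre posC
    with c∈B , c+1∈B ← merge-point-within (sum pre) 1≤a 1≤b
    = ∈-++⁺ˡ (corner-∈-colMarks posR c∈B c+1∈B cutR (proj₂ corner))

  slab-entry : ∀ {a b c e i j} → Slab M a b c e → Within i (a , b) → Within j (c , e) → entry M i j ≡ true
  slab-entry (_ , _ , _ , _ , _ , _ , ones) (a≤i , i≤b) (c≤j , j≤e) = ones _ _ a≤i i≤b c≤j j≤e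

  column-slab : ∀ {a b j} → a ≤ b → (∀ i → a ≤ i → i ≤ b → entry M i j ≡ true) → Slab M a b j j
  column-slab {a} {b} {j} a≤b ones =
    proj₁ (proj₁ top) , a≤b , proj₂ (proj₁ (entry-true⇒within (ones b a≤b ≤-refl))) ,
    proj₁ (proj₂ top) , ≤-refl , proj₂ (proj₂ top) ,
    λ i k a≤i i≤b j≤k k≤j → subst (λ k → entry M i k ≡ true) (≤-antisym j≤k k≤j) (ones i a≤i i≤b)
    where top = entry-true⇒within (ones a ≤-refl a≤b)

  strip-entry : ∀ {a b j i} → Strip M a b j → Within i (a , b) → entry M i j ≡ true
  strip-entry (slab , _) i∈ab = slab-entry slab i∈ab (≤-refl , ≤-refl)

  strip-bounds : ∀ {a b j} → Strip M a b j → a ≤ b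
  strip-bounds ((_ , a≤b , _) , _) = a≤b

  strip-above : ∀ {a b j} → Strip M a b j → entry M (a ∸ 1) j ≡ false
  strip-above {a} {b} {j} st@(_ , ¬up , _) with entry M (a ∸ 1) j in above
  ... | false = refl
  ... | true  = ⊥-elim (¬up (column-slab (≤-trans (m∸n≤m a 1) (strip-bounds st)) ones))
    where
    ones : ∀ i → a ∸ 1 ≤ i → i ≤ b → entry M i j ≡ true
    ones i a-1≤i i≤b with m≤n⇒m<n∨m≡n a-1≤i
    ... | inj₁ a-1<i = strip-entry st (∸1<⇒≤ a-1<i , i≤b)
    ... | inj₂ refl  = above

  strip-below : ∀ {a b j} → Strip M a b j → entry M (suc b) j ≡ false
  strip-below {a} {b} {j} st@(_ , _ , ¬down) with entry M (suc b) j in below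
  ... | false = refl
  ... | true  = ⊥-elim (¬down (column-slab (≤-trans (strip-bounds st) (n≤1+n b)) ones))
    where
    ones : ∀ i → a ≤ i → i ≤ suc b → entry M i j ≡ true
    ones i a≤i i≤b+1 with m≤n⇒m<n∨m≡n i≤b+1
    ... | inj₁ i<b+1 = strip-entry st (a≤i , ≤-pred i<b+1)
    ... | inj₂ refl  = below

  touching-strips-≡ : ∀ {a b a′ b′ j} → Strip M a b j → Strip M a′ b′ j →
                      a ∸ 1 ≤ b′ → a′ ∸ 1 ≤ b → a ≡ a′ × b ≡ b′
  touching-strips-≡ st st′ a-1≤b′ a′-1≤b with ≤-antisym (start-≤ st st′ a-1≤b′) (start-≤ st′ st a′-1≤b)
    where
    start-≤ : ∀ {a b a′ b′ j} → Strip M a b j → Strip M a′ b′ j → a ∸ 1 ≤ b′ → a ≤ a′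
    start-≤ st st′ a-1≤b′ = ≮⇒≥ λ a′<a →
      not-¬ (strip-entry st′ (∸-monoˡ-≤ 1 a′<a , a-1≤b′)) (strip-above st)
  ... | refl = refl , ≤-antisym (end-≤ st st′) (end-≤ st′ st)
    where
    end-≤ : ∀ {a b b′ j} → Strip M a b j → Strip M a b′ j → b ≤ b′
    end-≤ st st′ = ≮⇒≥ λ b′<b →
      not-¬ (strip-entry st (≤-trans (strip-bounds st′) (n≤1+n _) , b′<b)) (strip-below st′)

  strip-continues : ∀ {a b j} → Strip M (suc a) b j → (∀ r → a ≤ r → r ≤ b → ¬ Corner r j) →
                    Strip M (suc a) b (suc j)
  strip-continues {a} {b} {j} st cornerFree =
    column-slab a+1≤b ones ,
    (λ slab → not-¬ (slab-entry slab (≤-refl , ≤-trans (n≤1+n a) a+1≤b) (≤-refl , ≤-refl)) (proj₁ top)) ,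
    (λ slab → not-¬ (slab-entry slab (≤-trans a+1≤b (n≤1+n b) , ≤-refl) (≤-refl , ≤-refl)) bottom)
    where
    a+1≤b = strip-bounds st
    top : entry M a (suc j) ≡ false × entry M (suc a) (suc j) ≡ true
    top with ¬corner⇒agree (cornerFree a ≤-refl (≤-trans (n≤1+n a) a+1≤b))
    ... | inj₁ (left , _)      = ⊥-elim (not-¬ (trans left (strip-entry st (≤-refl , a+1≤b))) (strip-above st))
    ... | inj₂ (upper , lower) = trans (sym upper) (strip-above st) , trans (sym lower) (strip-entry st (≤-refl , a+1≤b))
    down : ∀ {r} → suc a ≤ r → suc r ≤ b → entry M r (suc j) ≡ true → entry M (suc r) (suc j) ≡ true
    down {r} a<r r<b one with ¬corner⇒agree (cornerFree r (≤-trans (n≤1+n a) a<r) (≤-trans (n≤1+n r) r<b))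
    ... | inj₁ (_ , right) = trans (sym right) one
    ... | inj₂ (_ , lower) = trans (sym lower) (strip-entry st (≤-trans a<r (n≤1+n r) , r<b))
    ones : ∀ i → suc a ≤ i → i ≤ b → entry M i (suc j) ≡ true
    ones (suc i) (s≤s a≤i) i+1≤b with m≤n⇒m<n∨m≡n a≤i
    ... | inj₂ refl = proj₂ top
    ... | inj₁ a<i  = down a<i i+1≤b (ones i a<i (≤-trans (n≤1+n i) i+1≤b))
    bottom : entry M (suc b) (suc j) ≡ false
    bottom with ¬corner⇒agree (cornerFree b (≤-trans (n≤1+n a) a+1≤b) ≤-refl)
    ... | inj₁ (left , _)  = ⊥-elim (not-¬ (strip-entry st (a+1≤b , ≤-refl)) (trans left (strip-below st)))
    ... | inj₂ (_ , lower) = trans (sym lower) (strip-below st)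

  last-strip : ∀ {a b i j} → CanonicalSlab M (a , b , i , j) → Strip M a b j
  last-strip (i≤j , strips , _) = strips _ i≤j ≤-refl

  canonical-start-≤ : ∀ {a b i i′ j} → CanonicalSlab M (a , b , i , j) → CanonicalSlab M (a , b , i′ , j) → i ≤ i′
  canonical-start-≤ {a} {b} {i} {i′} (i≤j , _ , maximal) (i′≤j , strips′ , _) with ≤-total i i′
  ... | inj₁ i≤i′ = i≤i′
  ... | inj₂ i′≤i = proj₁ (maximal i′ (strips′ i′ ≤-refl i′≤j) sibling)
    where
    sibling : Sibling M a b i i′
    sibling k i⊓i′≤k k≤i⊔i′ =
      strips′ k (subst (_≤ k) (m≥n⇒m⊓n≡n i′≤i) i⊓i′≤k)
                (≤-trans (subst (k ≤_) (m≥n⇒m⊔n≡m i′≤i) k≤i⊔i′) i≤j)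

  canonical-slab-injective : ∀ {a b i a′ b′ i′ j r} →
    CanonicalSlab M (a , b , i , j) → CanonicalSlab M (a′ , b′ , i′ , j) →
    Within r (a ∸ 1 , b) → Within r (a′ ∸ 1 , b′) → (a , b , i , j) ≡ (a′ , b′ , i′ , j)
  canonical-slab-injective cs cs′ (a-1≤r , r≤b) (a′-1≤r , r≤b′)
    with refl , refl ← touching-strips-≡ (last-strip cs) (last-strip cs′) (≤-trans a-1≤r r≤b′) (≤-trans a′-1≤r r≤b)
    rewrite ≤-antisym (canonical-start-≤ cs cs′) (canonical-start-≤ cs′ cs) = refl

  -- For j = n no case split is needed: column n + 1 is zero, so a corner is found at row b.
  canonical-corner : ∀ {a b i j} → CanonicalSlab M (a , b , i , j) → ∃ λ r → Within r (a ∸ 1 , b) × Corner r j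
  canonical-corner {zero} cs = ⊥-elim (n≮0 (proj₁ (proj₁ (last-strip cs))))
  canonical-corner {suc a} {b} {i} {j} cs@(i≤j , strips , maximal)
    with anyUpTo? (λ r → (a ≤? r) ×-dec corner? r j) (suc b)
  ... | yes (r , r<b+1 , a≤r , corner) = r , (a≤r , ≤-pred r<b+1) , corner
  ... | no noCorner = ⊥-elim (1+n≰n (proj₂ (maximal (suc j) next sibling)))
    where
    next : Strip M (suc a) b (suc j)
    next = strip-continues (last-strip cs) λ r a≤r r≤b corner → noCorner (r , s≤s r≤b , a≤r , corner)
    sibling : Sibling M (suc a) b i (suc j)
    sibling k i⊓j+1≤k k≤i⊔j+1 with m≤n⇒m<n∨m≡n (subst (k ≤_) (m≤n⇒m⊔n≡n (m≤n⇒m≤1+n i≤j)) k≤i⊔j+1)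
    ... | inj₁ k<j+1 = strips k (subst (_≤ k) (m≤n⇒m⊓n≡m (m≤n⇒m≤1+n i≤j)) i⊓j+1≤k) (≤-pred k<j+1)
    ... | inj₂ refl  = next

  corner-∈-candidates : (σ : Seq (initial n) (final n)) → ∀ {r j} → r ≤ n → Within j (1 , n) → Corner r j →
                        (r , j) ∈ seqMarks σ ++ border n
  corner-∈-candidates σ {zero} _ (_ , j≤n) _ =
    ∈-++⁺ʳ (seqMarks σ) (∈-++⁺ˡ (∈-map⁺ (0 ,_) (∈-upTo⁺ (s≤s j≤n))))
  corner-∈-candidates σ {suc r} {j} r+1≤n (1≤j , j≤n) corner with suc r <? n | j <? n
  ... | no r+1≮n | _ rewrite ≤-antisym r+1≤n (≮⇒≥ r+1≮n) =
    ∈-++⁺ʳ (seqMarks σ) (∈-++⁺ʳ (line n (0 ,_)) (∈-++⁺ˡ (∈-map⁺ (n ,_) (∈-upTo⁺ (s≤s j≤n)))))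
  ... | yes _ | no j≮n rewrite ≤-antisym j≤n (≮⇒≥ j≮n) =
    ∈-++⁺ʳ (seqMarks σ) (∈-++⁺ʳ (line n (0 ,_)) (∈-++⁺ʳ (line n (n ,_)) (∈-map⁺ (_, n) (∈-upTo⁺ (s≤s r+1≤n)))))
  ... | yes r+1<n | yes j<n =
    ∈-++⁺ˡ (corner-∈-seqMarks σ ones ones (s≤s z≤n) (cut-initial (s≤s z≤n) r+1<n) (cut-initial 1≤j j<n) corner)
    where ones = replicate⁺ n ≤-refl

  canonical-slabs-≤ : ∀ {d} → TwinOrdered d M → ∀ {L} → Unique L → All (CanonicalSlab M) L →
                      length L ≤ 2 * d * (n + n) + 3 * suc n
  canonical-slabs-≤ {d} (σ , ok) {L} unique canonical = begin
    length L                                ≤⟨ pigeonhole CornerOf (seqMarks σ ++ border n) unique witness injective ⟩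
    length (seqMarks σ ++ border n)         ≡⟨ length-++ (seqMarks σ) ⟩
    length (seqMarks σ) + length (border n) ≤⟨ +-mono-≤ marks-≤ (≤-reflexive (length-border n)) ⟩
    2 * d * (n + n) + 3 * suc n             ∎
    where
    open ≤-Reasoning
    CornerOf : ℕ × ℕ × ℕ × ℕ → ℕ × ℕ → Set
    CornerOf (a , b , _ , j) (r , c) = c ≡ j × Within r (a ∸ 1 , b)
    witness : ∀ {x} → x ∈ L → ∃ λ t → t ∈ seqMarks σ ++ border n × CornerOf x t
    witness {a , b , i , j} x∈L
      with r , r∈ , corner ← canonical-corner (All.lookup canonical x∈L)
      with (_ , _ , b≤n , 1≤j , _ , j≤n , _) , _ ← last-strip (All.lookup canonical x∈L)
      = (r , j) , corner-∈-candidates σ (≤-trans (proj₂ r∈) b≤n) (1≤j , j≤n) corner , refl , r∈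
    injective : ∀ {x y t} → x ∈ L → y ∈ L → CornerOf x t → CornerOf y t → x ≡ y
    injective {_ , _ , _ , _} {_ , _ , _ , _} x∈L y∈L (refl , r∈x) (refl , r∈y) =
      canonical-slab-injective (All.lookup canonical x∈L) (All.lookup canonical y∈L) r∈x r∈y
    marks-≤ : length (seqMarks σ) ≤ 2 * d * (n + n)
    marks-≤ = subst (λ m → length (seqMarks σ) ≤ 2 * d * m)
                (cong₂ _+_ (length-replicate n) (length-replicate n)) (length-seqMarks σ ok)

3*suc≤3f : ∀ d → 3 * suc d ≤ 3f d
3*suc≤3f d = begin
  3 * suc d            ≤⟨ *-mono-≤ (m≤n+m 3 (2 * d)) (≤-trans suc≤ (m≤m*n _ 1)) ⟩
  (2 * d + 3) ^ 2      ≤⟨ m≤n*m _ 16 ⟩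
  16 * (2 * d + 3) ^ 2 ≤⟨ m≤m*n _ (2 ^ (4 * (2 * d + 2))) {{m^n≢0 2 (4 * (2 * d + 2))}} ⟩
  3f d                 ∎
  where
  open ≤-Reasoning
  split : ∀ d → suc d + (d + 2) ≡ 2 * d + 3
  split = solve-∀
  suc≤ : suc d ≤ 2 * d + 3
  suc≤ = subst (suc d ≤_) (split d) (m≤m+n (suc d) (d + 2))

lemma4 : (d n : ℕ) (M : Matrix n) → TwinOrdered d M →
           (L : List (ℕ × ℕ × ℕ × ℕ)) → Unique L → All (CanonicalSlab M) L →
           3 * length L ≤ 4 * 3f d * (n + 2) + 12 * n
lemma4 d n M twinOrdered L unique canonical = begin
  3 * length L
    ≤⟨ *-monoʳ-≤ 3 (canonical-slabs-≤ M twinOrdered unique canonical) ⟩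
  3 * (2 * d * (n + n) + 3 * suc n)
    ≤⟨ m≤m+n _ (24 * d + 15 * n + 15) ⟩
  3 * (2 * d * (n + n) + 3 * suc n) + (24 * d + 15 * n + 15)
    ≡⟨ slack d n ⟩
  4 * (3 * suc d) * (n + 2) + 12 * n
    ≤⟨ +-monoˡ-≤ (12 * n) (*-monoˡ-≤ (n + 2) (*-monoʳ-≤ 4 (3*suc≤3f d))) ⟩
  4 * 3f d * (n + 2) + 12 * n
    ∎
  where
  open ≤-Reasoning
  slack : ∀ d n → 3 * (2 * d * (n + n) + 3 * suc n) + (24 * d + 15 * n + 15)
                  ≡ 4 * (3 * suc d) * (n + 2) + 12 * n
  slack = solve-∀
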